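{- For all integers $N\ge1$ and $n\ge1$, $$\sum_{k=0}^{(N-1)(n-1)}\frac{a_k(N,n)}{n^k}(N)_k=n^{N-1},$$ where the coefficients $a_k(N,n)$ are defined by $T_{N-1}(x)^{n-1}=\sum_{k=0}^{(N-1)(n-1)}a_k(N,n)x^k$.
   Context: For an integer $M\ge0$, $T_M(x)=\sum_{k=0}^{M}\frac{x^k}{k!}$. $(a)_k=a(a+1)\cdots(a+k-1)$ denotes the rising factorial, $(a)_0=1$. -}

module Defs where

open import Data.Nat using (ℕ; zero; suc; _∸_; _^_; _≤?_; _!)
  renaming (_*_ to _*ℕ_; _+_ to _+ℕ_)

open import Data.Integer using (+_)
open import Data.Rational using (ℚ; 0ℚ; 1ℚ; _+_; _*_; _/_)
open import Relation.Nullary using (yes; no)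

-- 1/m as a rational, for m ≥ 1 (junk value 0 at m = 0; only used with m ≥ 1)
recipℕ : ℕ → ℚ
recipℕ zero    = 0ℚ
recipℕ (suc m) = (+ 1) / suc m

ℕtoℚ : ℕ → ℚ
ℕtoℚ m = (+ m) / 1

sumTo : ℕ → (ℕ → ℚ) → ℚ
sumTo zero    f = f 0
sumTo (suc m) f = sumTo m f + f (suc m)

rising : ℕ → ℕ → ℕ
rising a zero    = 1
rising a (suc k) = rising a k *ℕ (a +ℕ k)

-- Polynomials with rational coefficients, as coefficient sequences ℕ → ℚ
Poly : Set
Poly = ℕ → ℚ

polyMul : Poly → Poly → Poly
polyMul f g k = sumTo k (λ i → f i * g (k ∸ i))

polyOne : Poly
polyOne zero    = 1ℚ
polyOne (suc _) = 0ℚ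

polyPow : Poly → ℕ → Poly
polyPow f zero    = polyOne
polyPow f (suc e) = polyMul f (polyPow f e)

T : ℕ → Poly
T M k with k ≤? M
... | yes _ = recipℕ (k !)
... | no  _ = 0ℚ

coeffA : ℕ → ℕ → ℕ → ℚ
coeffA N n k = polyPow (T (N ∸ 1)) (n ∸ 1) k

{-# OPTIONS --safe #-}
-- Write M = N - 1, T = T_M and b = T^(n-1). Then T' = T - x^M/M!, so c = T^n satisfies
-- c' = n (c - s) with s = x^M/M! · b. Pair a polynomial p with the weights k!/n^k,
-- L(p) = Σ p_k k!/n^k = n ∫₀^∞ p(x) e^(-nx) dx. Integration by parts, L(p') = n L(p) - n p(0),
-- turns c' = n (c - s) into L(s) = c(0) = 1; coefficientwise this is a telescoping sum.
-- Finally L(s) = Σ_j b_j (M+j)!/(M! n^(M+j)) = n^(-M) Σ_j b_j (N)_j / n^j.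

module Submission where

open import Defs
open import Data.Nat using (ℕ; zero; suc; _≤_; _<_; _∸_; _^_; _!; z≤n; NonZero)
  renaming (_*_ to _*ℕ_; _+_ to _+ℕ_)
import Data.Nat.Properties as ℕ
open import Data.Nat.Coprimality using (1-coprimeTo) renaming (sym to coprime-sym)
import Data.Integer as ℤ
import Data.Integer.Properties as ℤ
open import Data.Rational using (ℚ; mkℚ; _*_; _+_; 0ℚ; 1ℚ)
import Data.Rational.Properties as ℚ
open import Data.Rational.Solver using (module +-*-Solver)
open import Data.Sum using (inj₁; inj₂)
open import Function using (_∘_)
open import Relation.Binary.Definitions using (tri<; tri≈; tri>)
open import Relation.Binary.PropositionalEquality
open import Relation.Nullary using (yes; no; contradiction)
open import Algebra.Properties.CommutativeSemigroup ℕ.*-commutativeSemigroup using (x∙yz≈y∙zx)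
import Relation.Binary.Reasoning.Setoid as SetoidReasoning

open +-*-Solver using (solve; _:+_; _:*_; _:=_)

module ≗-Reasoning = SetoidReasoning (ℕ →-setoid ℚ)

+-interchange : ∀ a b c d → (a + b) + (c + d) ≡ (a + c) + (b + d)
+-interchange = solve 4 (λ a b c d → (a :+ b) :+ (c :+ d) := (a :+ c) :+ (b :+ d)) refl

ℕtoℚ-mkℚ : ∀ m → ℕtoℚ m ≡ mkℚ (ℤ.+ m) 0 (coprime-sym (1-coprimeTo m))
ℕtoℚ-mkℚ m = ℚ.↥p/↧p≡p _

ℕtoℚ-+ : ∀ a b → ℕtoℚ (a +ℕ b) ≡ ℕtoℚ a + ℕtoℚ b
ℕtoℚ-+ a b rewrite ℕtoℚ-mkℚ a | ℕtoℚ-mkℚ b = cong (Data.Rational._/ 1)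
  (trans (ℤ.pos-+ a b) (sym (cong₂ ℤ._+_ (ℤ.*-identityʳ (ℤ.+ a)) (ℤ.*-identityʳ (ℤ.+ b)))))

ℕtoℚ-* : ∀ a b → ℕtoℚ (a *ℕ b) ≡ ℕtoℚ a * ℕtoℚ b
ℕtoℚ-* a b rewrite ℕtoℚ-mkℚ a | ℕtoℚ-mkℚ b = cong (Data.Rational._/ 1) (ℤ.pos-* a b)

recipℕ-inverseˡ : ∀ a .{{_ : NonZero a}} → recipℕ a * ℕtoℚ a ≡ 1ℚ
recipℕ-inverseˡ (suc a)
  rewrite ℕtoℚ-mkℚ (suc a) | ℚ.↥p/↧p≡p (mkℚ (ℤ.+ 1) a (1-coprimeTo (suc a))) =
  ℚ.*-inverseˡ (mkℚ (ℤ.+ suc a) 0 (coprime-sym (1-coprimeTo (suc a))))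

inverseˡ≡inverseʳ : ∀ x y z → y * x ≡ 1ℚ → x * z ≡ 1ℚ → y ≡ z
inverseˡ≡inverseʳ x y z yx≡1 xz≡1 = begin
  y            ≡⟨ ℚ.*-identityʳ y ⟨
  y * 1ℚ       ≡⟨ cong (y *_) xz≡1 ⟨
  y * (x * z)  ≡⟨ ℚ.*-assoc y x z ⟨
  (y * x) * z  ≡⟨ cong (_* z) yx≡1 ⟩
  1ℚ * z       ≡⟨ ℚ.*-identityˡ z ⟩
  z            ∎
  where open ≡-Reasoning

recipℕ-* : ∀ a b .{{a≢0 : NonZero a}} .{{b≢0 : NonZero b}} →
           recipℕ (a *ℕ b) ≡ recipℕ a * recipℕ b
recipℕ-* a b =
  inverseˡ≡inverseʳ (ℕtoℚ (a *ℕ b)) _ _ (recipℕ-inverseˡ (a *ℕ b) {{ℕ.m*n≢0 a b}}) (begin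
    ℕtoℚ (a *ℕ b) * (recipℕ a * recipℕ b)
      ≡⟨ cong (_* (recipℕ a * recipℕ b)) (ℕtoℚ-* a b) ⟩
    (ℕtoℚ a * ℕtoℚ b) * (recipℕ a * recipℕ b)
      ≡⟨ solve 4 (λ a b a′ b′ → (a :* b) :* (a′ :* b′) := (a′ :* a) :* (b′ :* b)) refl
                 (ℕtoℚ a) (ℕtoℚ b) (recipℕ a) (recipℕ b) ⟩
    (recipℕ a * ℕtoℚ a) * (recipℕ b * ℕtoℚ b)
      ≡⟨ cong₂ _*_ (recipℕ-inverseˡ a) (recipℕ-inverseˡ b) ⟩
    1ℚ
      ∎)
  where open ≡-Reasoning

ℕtoℚ-*-recipℕ-* : ∀ a b .{{a≢0 : NonZero a}} .{{b≢0 : NonZero b}} →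
                  ℕtoℚ a * recipℕ (a *ℕ b) ≡ recipℕ b
ℕtoℚ-*-recipℕ-* a b = begin
  ℕtoℚ a * recipℕ (a *ℕ b)         ≡⟨ cong (ℕtoℚ a *_) (recipℕ-* a b) ⟩
  ℕtoℚ a * (recipℕ a * recipℕ b)   ≡⟨ ℚ.*-assoc (ℕtoℚ a) (recipℕ a) (recipℕ b) ⟨
  (ℕtoℚ a * recipℕ a) * recipℕ b   ≡⟨ cong (_* recipℕ b) (ℚ.*-comm (ℕtoℚ a) (recipℕ a)) ⟩
  (recipℕ a * ℕtoℚ a) * recipℕ b   ≡⟨ cong (_* recipℕ b) (recipℕ-inverseˡ a) ⟩
  1ℚ * recipℕ b                    ≡⟨ ℚ.*-identityˡ (recipℕ b) ⟩
  recipℕ b                         ∎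
  where open ≡-Reasoning

sumTo-cong : ∀ m {f g : ℕ → ℚ} → (∀ i → i ≤ m → f i ≡ g i) → sumTo m f ≡ sumTo m g
sumTo-cong zero    f≡g = f≡g 0 z≤n
sumTo-cong (suc m) f≡g =
  cong₂ _+_ (sumTo-cong m (λ i i≤m → f≡g i (ℕ.m≤n⇒m≤1+n i≤m))) (f≡g (suc m) ℕ.≤-refl)

sumTo-zero : ∀ m {f : ℕ → ℚ} → (∀ i → i ≤ m → f i ≡ 0ℚ) → sumTo m f ≡ 0ℚ
sumTo-zero zero    f≡0 = f≡0 0 z≤n
sumTo-zero (suc m) f≡0 =
  cong₂ _+_ (sumTo-zero m (λ i i≤m → f≡0 i (ℕ.m≤n⇒m≤1+n i≤m))) (f≡0 (suc m) ℕ.≤-refl)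

sumTo-distrib-+ : ∀ m (f g : ℕ → ℚ) → sumTo m (λ i → f i + g i) ≡ sumTo m f + sumTo m g
sumTo-distrib-+ zero    f g = refl
sumTo-distrib-+ (suc m) f g = trans (cong (_+ (f (suc m) + g (suc m))) (sumTo-distrib-+ m f g))
  (+-interchange (sumTo m f) (sumTo m g) (f (suc m)) (g (suc m)))

*-distribˡ-sumTo : ∀ m c (f : ℕ → ℚ) → c * sumTo m f ≡ sumTo m (λ i → c * f i)
*-distribˡ-sumTo zero    c f = refl
*-distribˡ-sumTo (suc m) c f = trans (ℚ.*-distribˡ-+ c (sumTo m f) (f (suc m)))
  (cong (_+ c * f (suc m)) (*-distribˡ-sumTo m c f))

sumTo-suc : ∀ m (f : ℕ → ℚ) → sumTo (suc m) f ≡ f 0 + sumTo m (f ∘ suc)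
sumTo-suc zero    f = refl
sumTo-suc (suc m) f = trans (cong (_+ f (suc (suc m))) (sumTo-suc m f))
  (ℚ.+-assoc (f 0) (sumTo m (f ∘ suc)) (f (suc (suc m))))

sumTo-telescope : ∀ {a b : ℕ → ℚ} → (∀ k → a (suc k) + b k ≡ a k) →
                  ∀ K → sumTo K b + a (suc K) ≡ a 0
sumTo-telescope {a} {b} step zero    = trans (ℚ.+-comm (b 0) (a 1)) (step 0)
sumTo-telescope {a} {b} step (suc K) = begin
  (sumTo K b + b (suc K)) + a (suc (suc K))  ≡⟨ ℚ.+-assoc (sumTo K b) (b (suc K)) (a (suc (suc K))) ⟩
  sumTo K b + (b (suc K) + a (suc (suc K)))  ≡⟨ cong (sumTo K b +_) (ℚ.+-comm (b (suc K)) (a (suc (suc K)))) ⟩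
  sumTo K b + (a (suc (suc K)) + b (suc K))  ≡⟨ cong (sumTo K b +_) (step (suc K)) ⟩
  sumTo K b + a (suc K)                      ≡⟨ sumTo-telescope step K ⟩
  a 0                                        ∎
  where open ≡-Reasoning

infixl 6 _⊕_
infixr 7 _•_

_⊕_ : Poly → Poly → Poly
(f ⊕ g) k = f k + g k

_•_ : ℚ → Poly → Poly
(r • f) k = r * f k

deriv : Poly → Poly
deriv f k = ℕtoℚ (suc k) * f (suc k)

shift : ℕ → Poly → Poly
shift zero    f k       = f k
shift (suc d) f zero    = 0ℚ
shift (suc d) f (suc k) = shift d f k

monomial : ℕ → ℚ → Poly
monomial d r = shift d (r • polyOne)

⊕-cong : ∀ {f f′ g g′ : Poly} → f ≗ f′ → g ≗ g′ → f ⊕ g ≗ f′ ⊕ g′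
⊕-cong f≗f′ g≗g′ k = cong₂ _+_ (f≗f′ k) (g≗g′ k)

⊕-congˡ : ∀ f {g g′ : Poly} → g ≗ g′ → f ⊕ g ≗ f ⊕ g′
⊕-congˡ f g≗g′ k = cong (f k +_) (g≗g′ k)

⊕-congʳ : ∀ g {f f′ : Poly} → f ≗ f′ → f ⊕ g ≗ f′ ⊕ g
⊕-congʳ g f≗f′ k = cong (_+ g k) (f≗f′ k)

•-congˡ : ∀ r {f g : Poly} → f ≗ g → r • f ≗ r • g
•-congˡ r f≗g k = cong (r *_) (f≗g k)

•-suc : ∀ e (f : Poly) → ℕtoℚ (suc e) • f ≗ f ⊕ ℕtoℚ e • f
•-suc e f k = begin
  ℕtoℚ (1 +ℕ e) * f k      ≡⟨ cong (_* f k) (ℕtoℚ-+ 1 e) ⟩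
  (1ℚ + ℕtoℚ e) * f k      ≡⟨ ℚ.*-distribʳ-+ (f k) 1ℚ (ℕtoℚ e) ⟩
  1ℚ * f k + ℕtoℚ e * f k  ≡⟨ cong (_+ ℕtoℚ e * f k) (ℚ.*-identityˡ (f k)) ⟩
  f k + ℕtoℚ e * f k       ∎
  where open ≡-Reasoning

shift-cong : ∀ d {f g : Poly} → f ≗ g → shift d f ≗ shift d g
shift-cong zero    f≗g k       = f≗g k
shift-cong (suc d) f≗g zero    = refl
shift-cong (suc d) f≗g (suc k) = shift-cong d f≗g k

polyMul-congˡ : ∀ f {g g′ : Poly} → g ≗ g′ → polyMul f g ≗ polyMul f g′
polyMul-congˡ f g≗g′ k = sumTo-cong k (λ i _ → cong (f i *_) (g≗g′ (k ∸ i)))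

polyMul-congʳ : ∀ g {f f′ : Poly} → f ≗ f′ → polyMul f g ≗ polyMul f′ g
polyMul-congʳ g f≗f′ k = sumTo-cong k (λ i _ → cong (_* g (k ∸ i)) (f≗f′ i))

polyMul-distribˡ-⊕ : ∀ f g h → polyMul f (g ⊕ h) ≗ polyMul f g ⊕ polyMul f h
polyMul-distribˡ-⊕ f g h k =
  trans (sumTo-cong k (λ i _ → ℚ.*-distribˡ-+ (f i) (g (k ∸ i)) (h (k ∸ i)))) (sumTo-distrib-+ k _ _)

polyMul-distribʳ-⊕ : ∀ f g h → polyMul (f ⊕ g) h ≗ polyMul f h ⊕ polyMul g h
polyMul-distribʳ-⊕ f g h k =
  trans (sumTo-cong k (λ i _ → ℚ.*-distribʳ-+ (h (k ∸ i)) (f i) (g i))) (sumTo-distrib-+ k _ _)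

polyMul-•ˡ : ∀ r f g → polyMul (r • f) g ≗ r • polyMul f g
polyMul-•ˡ r f g k =
  trans (sumTo-cong k (λ i _ → ℚ.*-assoc r (f i) (g (k ∸ i)))) (sym (*-distribˡ-sumTo k r _))

polyMul-•ʳ : ∀ r f g → polyMul f (r • g) ≗ r • polyMul f g
polyMul-•ʳ r f g k =
  trans (sumTo-cong k (λ i _ → left-comm (f i) (g (k ∸ i)))) (sym (*-distribˡ-sumTo k r _))
  where
  left-comm : ∀ x y → x * (r * y) ≡ r * (x * y)
  left-comm x y = solve 3 (λ r x y → x :* (r :* y) := r :* (x :* y)) refl r x y

polyMul-identityˡ : ∀ g → polyMul polyOne g ≗ g
polyMul-identityˡ g zero    = ℚ.*-identityˡ (g 0)
polyMul-identityˡ g (suc k) = begin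
  sumTo (suc k) (λ i → polyOne i * g (suc k ∸ i))
    ≡⟨ sumTo-suc k (λ i → polyOne i * g (suc k ∸ i)) ⟩
  1ℚ * g (suc k) + sumTo k (λ i → 0ℚ * g (k ∸ i))
    ≡⟨ cong₂ _+_ (ℚ.*-identityˡ (g (suc k))) (sumTo-zero k (λ i _ → ℚ.*-zeroˡ (g (k ∸ i)))) ⟩
  g (suc k) + 0ℚ
    ≡⟨ ℚ.+-identityʳ _ ⟩
  g (suc k)
    ∎
  where open ≡-Reasoning

deriv-polyMul : ∀ f g → deriv (polyMul f g) ≗ polyMul (deriv f) g ⊕ polyMul f (deriv g)
deriv-polyMul f g k = begin
  ℕtoℚ (suc k) * sumTo (suc k) t
    ≡⟨ *-distribˡ-sumTo (suc k) (ℕtoℚ (suc k)) t ⟩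
  sumTo (suc k) (λ i → ℕtoℚ (suc k) * t i)
    ≡⟨ sumTo-cong (suc k) split ⟩
  sumTo (suc k) (λ i → ℕtoℚ i * t i + ℕtoℚ (suc k ∸ i) * t i)
    ≡⟨ sumTo-distrib-+ (suc k) (λ i → ℕtoℚ i * t i) (λ i → ℕtoℚ (suc k ∸ i) * t i) ⟩
  sumTo (suc k) (λ i → ℕtoℚ i * t i) + sumTo (suc k) (λ i → ℕtoℚ (suc k ∸ i) * t i)
    ≡⟨ cong₂ _+_ deriv-left deriv-right ⟩
  polyMul (deriv f) g k + polyMul f (deriv g) k
    ∎
  where
  open ≡-Reasoning
  t : ℕ → ℚ
  t i = f i * g (suc k ∸ i)

  split : ∀ i → i ≤ suc k → ℕtoℚ (suc k) * t i ≡ ℕtoℚ i * t i + ℕtoℚ (suc k ∸ i) * t i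
  split i i≤1+k = begin
    ℕtoℚ (suc k) * t i                     ≡⟨ cong (λ n → ℕtoℚ n * t i) (ℕ.m+[n∸m]≡n i≤1+k) ⟨
    ℕtoℚ (i +ℕ (suc k ∸ i)) * t i          ≡⟨ cong (_* t i) (ℕtoℚ-+ i (suc k ∸ i)) ⟩
    (ℕtoℚ i + ℕtoℚ (suc k ∸ i)) * t i      ≡⟨ ℚ.*-distribʳ-+ (t i) (ℕtoℚ i) (ℕtoℚ (suc k ∸ i)) ⟩
    ℕtoℚ i * t i + ℕtoℚ (suc k ∸ i) * t i  ∎

  deriv-left : sumTo (suc k) (λ i → ℕtoℚ i * t i) ≡ polyMul (deriv f) g k
  deriv-left = begin
    sumTo (suc k) (λ i → ℕtoℚ i * t i)
      ≡⟨ sumTo-suc k (λ i → ℕtoℚ i * t i) ⟩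
    0ℚ * t 0 + sumTo k (λ i → ℕtoℚ (suc i) * (f (suc i) * g (k ∸ i)))
      ≡⟨ cong₂ _+_ (ℚ.*-zeroˡ (t 0))
                   (sumTo-cong k (λ i _ → sym (ℚ.*-assoc (ℕtoℚ (suc i)) (f (suc i)) (g (k ∸ i))))) ⟩
    0ℚ + polyMul (deriv f) g k
      ≡⟨ ℚ.+-identityˡ _ ⟩
    polyMul (deriv f) g k
      ∎

  deriv-right : sumTo (suc k) (λ i → ℕtoℚ (suc k ∸ i) * t i) ≡ polyMul f (deriv g) k
  deriv-right = begin
    sumTo k (λ i → ℕtoℚ (suc k ∸ i) * t i) + ℕtoℚ (k ∸ k) * t (suc k)
      ≡⟨ cong₂ _+_ (sumTo-cong k term)
                   (trans (cong (λ n → ℕtoℚ n * t (suc k)) (ℕ.n∸n≡0 k)) (ℚ.*-zeroˡ (t (suc k)))) ⟩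
    polyMul f (deriv g) k + 0ℚ
      ≡⟨ ℚ.+-identityʳ _ ⟩
    polyMul f (deriv g) k
      ∎
    where
    term : ∀ i → i ≤ k → ℕtoℚ (suc k ∸ i) * t i ≡ f i * deriv g (k ∸ i)
    term i i≤k rewrite ℕ.+-∸-assoc 1 i≤k =
      solve 3 (λ n a b → n :* (a :* b) := a :* (n :* b)) refl
              (ℕtoℚ (suc (k ∸ i))) (f i) (g (suc (k ∸ i)))

polyMul-shiftˡ : ∀ d f g → polyMul (shift d f) g ≗ shift d (polyMul f g)
polyMul-shiftˡ zero    f g k       = refl
polyMul-shiftˡ (suc d) f g zero    = ℚ.*-zeroˡ (g 0)
polyMul-shiftˡ (suc d) f g (suc k) = begin
  sumTo (suc k) (λ i → shift (suc d) f i * g (suc k ∸ i))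
    ≡⟨ sumTo-suc k (λ i → shift (suc d) f i * g (suc k ∸ i)) ⟩
  0ℚ * g (suc k) + polyMul (shift d f) g k
    ≡⟨ cong₂ _+_ (ℚ.*-zeroˡ (g (suc k))) (polyMul-shiftˡ d f g k) ⟩
  0ℚ + shift d (polyMul f g) k
    ≡⟨ ℚ.+-identityˡ _ ⟩
  shift d (polyMul f g) k
    ∎
  where open ≡-Reasoning

polyMul-shiftʳ : ∀ d f g → polyMul f (shift d g) ≗ shift d (polyMul f g)
polyMul-shiftʳ zero    f g k       = refl
polyMul-shiftʳ (suc d) f g zero    = ℚ.*-zeroʳ (f 0)
polyMul-shiftʳ (suc d) f g (suc k) = begin
  sumTo k (λ i → f i * shift (suc d) g (suc k ∸ i)) + f (suc k) * shift (suc d) g (k ∸ k)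
    ≡⟨ cong₂ _+_
         (sumTo-cong k (λ i i≤k → cong (λ j → f i * shift (suc d) g j) (ℕ.+-∸-assoc 1 i≤k)))
         (trans (cong (λ j → f (suc k) * shift (suc d) g j) (ℕ.n∸n≡0 k)) (ℚ.*-zeroʳ (f (suc k)))) ⟩
  polyMul f (shift d g) k + 0ℚ
    ≡⟨ ℚ.+-identityʳ _ ⟩
  polyMul f (shift d g) k
    ≡⟨ polyMul-shiftʳ d f g k ⟩
  shift d (polyMul f g) k
    ∎
  where open ≡-Reasoning

polyMul-monomialˡ : ∀ d r g → polyMul (monomial d r) g ≗ shift d (r • g)
polyMul-monomialˡ d r g k = trans (polyMul-shiftˡ d (r • polyOne) g k)
  (shift-cong d (λ j → trans (polyMul-•ˡ r polyOne g j) (cong (r *_) (polyMul-identityˡ g j))) k)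

polyMul-monomial-comm : ∀ d r f g →
  polyMul f (polyMul (monomial d r) g) ≗ polyMul (monomial d r) (polyMul f g)
polyMul-monomial-comm d r f g = begin
  polyMul f (polyMul (monomial d r) g)  ≈⟨ polyMul-congˡ f (polyMul-monomialˡ d r g) ⟩
  polyMul f (shift d (r • g))           ≈⟨ polyMul-shiftʳ d f (r • g) ⟩
  shift d (polyMul f (r • g))           ≈⟨ shift-cong d (polyMul-•ʳ r f g) ⟩
  shift d (r • polyMul f g)             ≈⟨ polyMul-monomialˡ d r (polyMul f g) ⟨
  polyMul (monomial d r) (polyMul f g)  ∎
  where open ≗-Reasoning

monomial-≡ : ∀ d r → monomial d r d ≡ r
monomial-≡ zero    r = ℚ.*-identityʳ r
monomial-≡ (suc d) r = monomial-≡ d r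

monomial-≢ : ∀ d r {k} → k ≢ d → monomial d r k ≡ 0ℚ
monomial-≢ zero    r {zero}  0≢0   = contradiction refl 0≢0
monomial-≢ zero    r {suc k} _     = ℚ.*-zeroʳ r
monomial-≢ (suc d) r {zero}  _     = refl
monomial-≢ (suc d) r {suc k} k+1≢d+1 = monomial-≢ d r (k+1≢d+1 ∘ cong suc)

module _ (d : ℕ) (r : ℚ) (f : Poly) (deriv-f : deriv f ⊕ monomial d r ≗ f) where

  deriv-polyPow : ∀ e →
    deriv (polyPow f (suc e)) ⊕ ℕtoℚ (suc e) • polyMul (monomial d r) (polyPow f e)
      ≗ ℕtoℚ (suc e) • polyPow f (suc e)
  polyMul-deriv-polyPow : ∀ e →
    polyMul f (deriv (polyPow f e)) ⊕ ℕtoℚ e • polyMul (monomial d r) (polyPow f e)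
      ≗ ℕtoℚ e • polyPow f (suc e)

  deriv-polyPow e = begin
    deriv (polyMul f P) ⊕ ℕtoℚ (suc e) • GP
      ≈⟨ ⊕-cong (deriv-polyMul f P) (•-suc e GP) ⟩
    (polyMul (deriv f) P ⊕ polyMul f (deriv P)) ⊕ (GP ⊕ ℕtoℚ e • GP)
      ≈⟨ (λ k → +-interchange (polyMul (deriv f) P k) (polyMul f (deriv P) k) (GP k) _) ⟩
    (polyMul (deriv f) P ⊕ GP) ⊕ (polyMul f (deriv P) ⊕ ℕtoℚ e • GP)
      ≈⟨ ⊕-congʳ _ (polyMul-distribʳ-⊕ (deriv f) (monomial d r) P) ⟨
    polyMul (deriv f ⊕ monomial d r) P ⊕ (polyMul f (deriv P) ⊕ ℕtoℚ e • GP)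
      ≈⟨ ⊕-cong (polyMul-congʳ P deriv-f) (polyMul-deriv-polyPow e) ⟩
    polyMul f P ⊕ ℕtoℚ e • polyMul f P
      ≈⟨ •-suc e (polyMul f P) ⟨
    ℕtoℚ (suc e) • polyMul f P
      ∎
    where
    open ≗-Reasoning
    P  = polyPow f e
    GP = polyMul (monomial d r) P

  polyMul-deriv-polyPow zero k = begin
    polyMul f (deriv polyOne) k + 0ℚ * polyMul (monomial d r) polyOne k
      ≡⟨ cong₂ _+_
           (sumTo-zero k (λ i _ → trans (cong (f i *_) (ℚ.*-zeroʳ (ℕtoℚ (suc (k ∸ i))))) (ℚ.*-zeroʳ (f i))))
           (ℚ.*-zeroˡ (polyMul (monomial d r) polyOne k)) ⟩
    0ℚ + 0ℚ
      ≡⟨ ℚ.*-zeroˡ (polyPow f 1 k) ⟨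
    0ℚ * polyPow f 1 k
      ∎
    where open ≡-Reasoning
  polyMul-deriv-polyPow (suc e) = begin
    polyMul f (deriv P) ⊕ n • polyMul G (polyMul f Q)
      ≈⟨ ⊕-congˡ (polyMul f (deriv P)) (•-congˡ n (polyMul-monomial-comm d r f Q)) ⟨
    polyMul f (deriv P) ⊕ n • polyMul f (polyMul G Q)
      ≈⟨ ⊕-congˡ (polyMul f (deriv P)) (polyMul-•ʳ n f (polyMul G Q)) ⟨
    polyMul f (deriv P) ⊕ polyMul f (n • polyMul G Q)
      ≈⟨ polyMul-distribˡ-⊕ f (deriv P) (n • polyMul G Q) ⟨
    polyMul f (deriv P ⊕ n • polyMul G Q)
      ≈⟨ polyMul-congˡ f (deriv-polyPow e) ⟩
    polyMul f (n • P)
      ≈⟨ polyMul-•ʳ n f P ⟩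
    n • polyMul f P
      ∎
    where
    open ≗-Reasoning
    n = ℕtoℚ (suc e)
    G = monomial d r
    Q = polyPow f e
    P = polyMul f Q

T-≤ : ∀ M {k} → k ≤ M → T M k ≡ recipℕ (k !)
T-≤ M {k} k≤M with k ℕ.≤? M
... | yes _   = refl
... | no  k≰M = contradiction k≤M k≰M

T-> : ∀ M {k} → M < k → T M k ≡ 0ℚ
T-> M {k} M<k with k ℕ.≤? M
... | yes k≤M = contradiction k≤M (ℕ.<⇒≱ M<k)
... | no  _   = refl

deriv-T : ∀ M → deriv (T M) ⊕ monomial M (recipℕ (M !)) ≗ T M
deriv-T M k with ℕ.<-cmp k M
... | tri< k<M _ _ = begin
  ℕtoℚ (suc k) * T M (suc k) + monomial M (recipℕ (M !)) k
    ≡⟨ cong₂ _+_ (cong (ℕtoℚ (suc k) *_) (T-≤ M k<M))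
                 (monomial-≢ M (recipℕ (M !)) (ℕ.<⇒≢ k<M)) ⟩
  ℕtoℚ (suc k) * recipℕ (suc k *ℕ k !) + 0ℚ
    ≡⟨ ℚ.+-identityʳ _ ⟩
  ℕtoℚ (suc k) * recipℕ (suc k *ℕ k !)
    ≡⟨ ℕtoℚ-*-recipℕ-* (suc k) (k !) {{b≢0 = ℕ._!≢0 k}} ⟩
  recipℕ (k !)
    ≡⟨ T-≤ M (ℕ.<⇒≤ k<M) ⟨
  T M k
    ∎
  where open ≡-Reasoning
... | tri≈ _ refl _ = begin
  ℕtoℚ (suc k) * T k (suc k) + monomial k (recipℕ (k !)) k
    ≡⟨ cong₂ _+_ (trans (cong (ℕtoℚ (suc k) *_) (T-> k (ℕ.n<1+n k))) (ℚ.*-zeroʳ (ℕtoℚ (suc k))))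
                 (monomial-≡ k (recipℕ (k !))) ⟩
  0ℚ + recipℕ (k !)
    ≡⟨ ℚ.+-identityˡ _ ⟩
  recipℕ (k !)
    ≡⟨ T-≤ k ℕ.≤-refl ⟨
  T k k
    ∎
  where open ≡-Reasoning
... | tri> _ _ M<k = begin
  ℕtoℚ (suc k) * T M (suc k) + monomial M (recipℕ (M !)) k
    ≡⟨ cong₂ _+_ (trans (cong (ℕtoℚ (suc k) *_) (T-> M (ℕ.m<n⇒m<1+n M<k))) (ℚ.*-zeroʳ (ℕtoℚ (suc k))))
                 (monomial-≢ M (recipℕ (M !)) (ℕ.>⇒≢ M<k)) ⟩
  0ℚ + 0ℚ
    ≡⟨ T-> M M<k ⟨
  T M k
    ∎
  where open ≡-Reasoning

Degree≤ : ℕ → Poly → Set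
Degree≤ a f = ∀ k → a < k → f k ≡ 0ℚ

T-Degree≤ : ∀ M → Degree≤ M (T M)
T-Degree≤ M k = T-> M

polyMul-Degree≤ : ∀ {a b f g} → Degree≤ a f → Degree≤ b g → Degree≤ (a +ℕ b) (polyMul f g)
polyMul-Degree≤ {a} {b} {f} {g} f≤a g≤b k a+b<k = sumTo-zero k term
  where
  term : ∀ i → i ≤ k → f i * g (k ∸ i) ≡ 0ℚ
  term i _ with ℕ.≤-<-connex i a
  ... | inj₂ a<i = trans (cong (_* g (k ∸ i)) (f≤a i a<i)) (ℚ.*-zeroˡ (g (k ∸ i)))
  ... | inj₁ i≤a = trans (cong (f i *_) (g≤b (k ∸ i) b<k∸i)) (ℚ.*-zeroʳ (f i))
    where
    b<k∸i : b < k ∸ i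
    b<k∸i = subst (_< k ∸ i) (ℕ.m+n∸m≡n i b)
      (ℕ.∸-monoˡ-< (ℕ.≤-<-trans (ℕ.+-monoˡ-≤ b i≤a) a+b<k) (ℕ.m≤m+n i b))

polyPow-Degree≤ : ∀ {a f} → Degree≤ a f → ∀ e → Degree≤ (e *ℕ a) (polyPow f e)
polyPow-Degree≤ f≤a zero    (suc k) _ = refl
polyPow-Degree≤ f≤a (suc e)           = polyMul-Degree≤ f≤a (polyPow-Degree≤ f≤a e)

polyPow-at-0 : ∀ f → f 0 ≡ 1ℚ → ∀ e → polyPow f e 0 ≡ 1ℚ
polyPow-at-0 f f0≡1 zero    = refl
polyPow-at-0 f f0≡1 (suc e) = cong₂ _*_ f0≡1 (polyPow-at-0 f f0≡1 e)

weight : ℕ → ℕ → ℚ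
weight n k = ℕtoℚ (k !) * recipℕ (n ^ k)

weight-suc : ∀ n .{{_ : NonZero n}} k → weight n (suc k) ≡ (weight n k * recipℕ n) * ℕtoℚ (suc k)
weight-suc n k = begin
  ℕtoℚ (suc k *ℕ k !) * recipℕ (n *ℕ n ^ k)
    ≡⟨ cong₂ _*_ (ℕtoℚ-* (suc k) (k !)) (recipℕ-* n (n ^ k) {{b≢0 = ℕ.m^n≢0 n k}}) ⟩
  (ℕtoℚ (suc k) * ℕtoℚ (k !)) * (recipℕ n * recipℕ (n ^ k))
    ≡⟨ solve 4 (λ s f ρ ρₖ → (s :* f) :* (ρ :* ρₖ) := ((f :* ρₖ) :* ρ) :* s) refl
               (ℕtoℚ (suc k)) (ℕtoℚ (k !)) (recipℕ n) (recipℕ (n ^ k)) ⟩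
  (weight n k * recipℕ n) * ℕtoℚ (suc k)
    ∎
  where open ≡-Reasoning

weighted-telescope : ∀ n .{{_ : NonZero n}} (c s : Poly) K →
  deriv c ⊕ ℕtoℚ n • s ≗ ℕtoℚ n • c → c 0 ≡ 1ℚ → c (suc K) ≡ 0ℚ →
  sumTo K (λ k → weight n k * s k) ≡ 1ℚ
weighted-telescope n c s K c′ c0≡1 c[1+K]≡0 = begin
  sumTo K (λ k → weight n k * s k)
    ≡⟨ ℚ.+-identityʳ _ ⟨
  sumTo K (λ k → weight n k * s k) + 0ℚ
    ≡⟨ cong (λ x → sumTo K (λ k → weight n k * s k) + x)
            (trans (cong (weight n (suc K) *_) c[1+K]≡0) (ℚ.*-zeroʳ (weight n (suc K)))) ⟨
  sumTo K (λ k → weight n k * s k) + weight n (suc K) * c (suc K)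
    ≡⟨ sumTo-telescope step K ⟩
  weight n 0 * c 0
    ≡⟨ cong (weight n 0 *_) c0≡1 ⟩
  1ℚ
    ∎
  where
  open ≡-Reasoning
  step : ∀ k → weight n (suc k) * c (suc k) + weight n k * s k ≡ weight n k * c k
  step k = begin
    weight n (suc k) * c (suc k) + w * s k
      ≡⟨ cong₂ _+_ (cong (_* c (suc k)) (weight-suc n k)) (cancel (s k)) ⟩
    ((w * ρ) * ℕtoℚ (suc k)) * c (suc k) + (w * ρ) * (ℕtoℚ n * s k)
      ≡⟨ cong (_+ (w * ρ) * (ℕtoℚ n * s k)) (ℚ.*-assoc (w * ρ) (ℕtoℚ (suc k)) (c (suc k))) ⟩
    (w * ρ) * deriv c k + (w * ρ) * (ℕtoℚ n * s k)
      ≡⟨ ℚ.*-distribˡ-+ (w * ρ) (deriv c k) (ℕtoℚ n * s k) ⟨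
    (w * ρ) * (deriv c k + ℕtoℚ n * s k)
      ≡⟨ cong ((w * ρ) *_) (c′ k) ⟩
    (w * ρ) * (ℕtoℚ n * c k)
      ≡⟨ cancel (c k) ⟨
    w * c k
      ∎
    where
    w = weight n k
    ρ = recipℕ n
    cancel : ∀ x → w * x ≡ (w * ρ) * (ℕtoℚ n * x)
    cancel x = begin
      w * x                      ≡⟨ cong (w *_) (ℚ.*-identityˡ x) ⟨
      w * (1ℚ * x)               ≡⟨ cong (λ y → w * (y * x)) (recipℕ-inverseˡ n) ⟨
      w * ((ρ * ℕtoℚ n) * x)     ≡⟨ solve 4 (λ w ρ ν x → w :* ((ρ :* ν) :* x) := (w :* ρ) :* (ν :* x))
                                            refl w ρ (ℕtoℚ n) x ⟩
      (w * ρ) * (ℕtoℚ n * x)     ∎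

sumTo-shift : ∀ d K (h f : ℕ → ℚ) →
  sumTo (d +ℕ K) (λ k → h k * shift d f k) ≡ sumTo K (λ j → h (d +ℕ j) * f j)
sumTo-shift zero    K h f = refl
sumTo-shift (suc d) K h f = begin
  sumTo (suc (d +ℕ K)) (λ k → h k * shift (suc d) f k)
    ≡⟨ sumTo-suc (d +ℕ K) (λ k → h k * shift (suc d) f k) ⟩
  h 0 * 0ℚ + sumTo (d +ℕ K) (λ k → h (suc k) * shift d f k)
    ≡⟨ cong (_+ sumTo (d +ℕ K) (λ k → h (suc k) * shift d f k)) (ℚ.*-zeroʳ (h 0)) ⟩
  0ℚ + sumTo (d +ℕ K) (λ k → h (suc k) * shift d f k)
    ≡⟨ ℚ.+-identityˡ _ ⟩
  sumTo (d +ℕ K) (λ k → h (suc k) * shift d f k)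
    ≡⟨ sumTo-shift d K (h ∘ suc) f ⟩
  sumTo K (λ j → h (suc d +ℕ j) * f j)
    ∎
  where open ≡-Reasoning

[m+j]!≡m!*rising : ∀ m j → (m +ℕ j) ! ≡ m ! *ℕ rising (suc m) j
[m+j]!≡m!*rising m zero    = trans (cong _! (ℕ.+-identityʳ m)) (sym (ℕ.*-identityʳ (m !)))
[m+j]!≡m!*rising m (suc j) = begin
  (m +ℕ suc j) !                              ≡⟨ cong _! (ℕ.+-suc m j) ⟩
  suc (m +ℕ j) *ℕ (m +ℕ j) !                  ≡⟨ cong (suc (m +ℕ j) *ℕ_) ([m+j]!≡m!*rising m j) ⟩
  suc (m +ℕ j) *ℕ (m ! *ℕ rising (suc m) j)   ≡⟨ x∙yz≈y∙zx (suc (m +ℕ j)) (m !) (rising (suc m) j) ⟩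
  m ! *ℕ (rising (suc m) j *ℕ suc (m +ℕ j))   ∎
  where open ≡-Reasoning

weight-+ : ∀ n .{{_ : NonZero n}} m j →
  weight n (m +ℕ j) * recipℕ (m !) ≡ recipℕ (n ^ m) * (ℕtoℚ (rising (suc m) j) * recipℕ (n ^ j))
weight-+ n m j = begin
  ℕtoℚ ((m +ℕ j) !) * recipℕ (n ^ (m +ℕ j)) * recipℕ (m !)
    ≡⟨ cong₂ (λ a b → ℕtoℚ a * recipℕ b * recipℕ (m !))
             ([m+j]!≡m!*rising m j) (ℕ.^-distribˡ-+-* n m j) ⟩
  ℕtoℚ (m ! *ℕ rising (suc m) j) * recipℕ (n ^ m *ℕ n ^ j) * recipℕ (m !)
    ≡⟨ cong₂ (λ a b → a * b * recipℕ (m !)) (ℕtoℚ-* (m !) (rising (suc m) j))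
             (recipℕ-* (n ^ m) (n ^ j) {{ℕ.m^n≢0 n m}} {{ℕ.m^n≢0 n j}}) ⟩
  (ℕtoℚ (m !) * ρ) * (recipℕ (n ^ m) * recipℕ (n ^ j)) * recipℕ (m !)
    ≡⟨ solve 5 (λ f ρ a b r → (f :* ρ) :* (a :* b) :* r := (r :* f) :* (a :* (ρ :* b))) refl
               (ℕtoℚ (m !)) ρ (recipℕ (n ^ m)) (recipℕ (n ^ j)) (recipℕ (m !)) ⟩
  (recipℕ (m !) * ℕtoℚ (m !)) * (recipℕ (n ^ m) * (ρ * recipℕ (n ^ j)))
    ≡⟨ cong (_* (recipℕ (n ^ m) * (ρ * recipℕ (n ^ j)))) (recipℕ-inverseˡ (m !) {{ℕ._!≢0 m}}) ⟩
  1ℚ * (recipℕ (n ^ m) * (ρ * recipℕ (n ^ j)))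
    ≡⟨ ℚ.*-identityˡ _ ⟩
  recipℕ (n ^ m) * (ρ * recipℕ (n ^ j))
    ∎
  where
  open ≡-Reasoning
  ρ = ℕtoℚ (rising (suc m) j)

weighted-sum-monomial : ∀ n .{{_ : NonZero n}} M K (b : Poly) →
  sumTo (M +ℕ K) (λ k → weight n k * polyMul (monomial M (recipℕ (M !))) b k)
    ≡ recipℕ (n ^ M) * sumTo K (λ j → (b j * recipℕ (n ^ j)) * ℕtoℚ (rising (suc M) j))
weighted-sum-monomial n M K b = begin
  sumTo (M +ℕ K) (λ k → weight n k * polyMul (monomial M r) b k)
    ≡⟨ sumTo-cong (M +ℕ K) (λ k _ → cong (weight n k *_) (polyMul-monomialˡ M r b k)) ⟩
  sumTo (M +ℕ K) (λ k → weight n k * shift M (r • b) k)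
    ≡⟨ sumTo-shift M K (weight n) (r • b) ⟩
  sumTo K (λ j → weight n (M +ℕ j) * (r * b j))
    ≡⟨ sumTo-cong K (λ j _ → term j) ⟩
  sumTo K (λ j → recipℕ (n ^ M) * ((b j * recipℕ (n ^ j)) * ℕtoℚ (rising (suc M) j)))
    ≡⟨ *-distribˡ-sumTo K (recipℕ (n ^ M)) _ ⟨
  recipℕ (n ^ M) * sumTo K (λ j → (b j * recipℕ (n ^ j)) * ℕtoℚ (rising (suc M) j))
    ∎
  where
  open ≡-Reasoning
  r = recipℕ (M !)
  term : ∀ j → weight n (M +ℕ j) * (r * b j)
             ≡ recipℕ (n ^ M) * ((b j * recipℕ (n ^ j)) * ℕtoℚ (rising (suc M) j))
  term j = begin
    weight n (M +ℕ j) * (r * b j)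
      ≡⟨ ℚ.*-assoc (weight n (M +ℕ j)) r (b j) ⟨
    (weight n (M +ℕ j) * r) * b j
      ≡⟨ cong (_* b j) (weight-+ n M j) ⟩
    (recipℕ (n ^ M) * (ℕtoℚ (rising (suc M) j) * recipℕ (n ^ j))) * b j
      ≡⟨ solve 4 (λ a ρ ν x → (a :* (ρ :* ν)) :* x := a :* ((x :* ν) :* ρ)) refl
                 (recipℕ (n ^ M)) (ℕtoℚ (rising (suc M) j)) (recipℕ (n ^ j)) (b j) ⟩
    recipℕ (n ^ M) * ((b j * recipℕ (n ^ j)) * ℕtoℚ (rising (suc M) j))
      ∎

lemma2p5 : (N n : ℕ) → 1 ≤ N → 1 ≤ n →
    sumTo ((N ∸ 1) *ℕ (n ∸ 1))
      (λ k → (coeffA N n k * recipℕ (n ^ k)) * ℕtoℚ (rising N k))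
    ≡ ℕtoℚ (n ^ (N ∸ 1))
lemma2p5 (suc M) (suc m) _ _ =
  inverseˡ≡inverseʳ (recipℕ (n ^ M)) _ _ normalised (recipℕ-inverseˡ (n ^ M) {{ℕ.m^n≢0 n M}})
  where
  open ≡-Reasoning
  n = suc m
  b = polyPow (T M) m
  Y : ℕ → ℚ
  Y j = (b j * recipℕ (n ^ j)) * ℕtoℚ (rising (suc M) j)

  normalised : sumTo (M *ℕ m) Y * recipℕ (n ^ M) ≡ 1ℚ
  normalised = begin
    sumTo (M *ℕ m) Y * recipℕ (n ^ M)
      ≡⟨ ℚ.*-comm (sumTo (M *ℕ m) Y) (recipℕ (n ^ M)) ⟩
    recipℕ (n ^ M) * sumTo (M *ℕ m) Y
      ≡⟨ cong (λ K → recipℕ (n ^ M) * sumTo K Y) (ℕ.*-comm M m) ⟩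
    recipℕ (n ^ M) * sumTo (m *ℕ M) Y
      ≡⟨ weighted-sum-monomial n M (m *ℕ M) b ⟨
    sumTo (n *ℕ M) (λ k → weight n k * polyMul (monomial M (recipℕ (M !))) b k)
      ≡⟨ weighted-telescope n (polyPow (T M) n) _ (n *ℕ M)
           (deriv-polyPow M (recipℕ (M !)) (T M) (deriv-T M) m)
           (polyPow-at-0 (T M) (T-≤ M z≤n) n)
           (polyPow-Degree≤ (T-Degree≤ M) n (suc (n *ℕ M)) ℕ.≤-refl) ⟩
    1ℚ
      ∎
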